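{- Let $G$ be a bipartite graph with partite sets $V_1$ and $V_2$ and minimum degree $\delta(G)\ge 2$. Then for every $T\subseteq V(G)$, \[ C_G(T)\subseteq C_G^*(T\cap V_1)\cup C_G^*(T\cap V_2). \]
   Context: Graphs are finite and simple. For $T\subseteq V(G)$, the zero forcing closure $C_G(T)$ is obtained by repeatedly doing the following until impossible: if some vertex $x$ in the current set has exactly one neighbor outside the current set, add that neighbor to the set. The star closure $C_G^*(T)$ is obtained by repeatedly doing the following until impossible: if some vertex $x$ of $G$ (in the current set or not) has exactly one neighbor outside the current set, add that neighbor to the set. -}

module Defs where

open import Data.Nat using (ℕ; _≤_)
open import Data.Bool using (Bool; true; false)
open import Data.Fin using (Fin)
open import Data.Fin.Subset using (Subset; ∣_∣)
open import Data.Vec using (tabulate)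
open import Data.Product using (_×_)
open import Data.Sum using (_⊎_)
open import Relation.Binary.PropositionalEquality using (_≡_; _≢_)

record Graph : Set where
  field
    n      : ℕ
    adj    : Fin n → Fin n → Bool
    sym    : ∀ u v → adj u v ≡ adj v u
    irrefl : ∀ v → adj v v ≡ false

open Graph public

VSet : Graph → Set₁
VSet G = Fin (n G) → Set

N : (G : Graph) → Fin (n G) → Subset (n G)
N G v = tabulate (adj G v)

deg : (G : Graph) → Fin (n G) → ℕ
deg G v = ∣ N G v ∣

MinDegAtLeast : Graph → ℕ → Set
MinDegAtLeast G k = ∀ v → k ≤ deg G v

-- Bipartition: V1 = {v | part v ≡ true}, V2 = {v | part v ≡ false},
-- every edge joins V1 and V2.
IsBipartition : (G : Graph) → (Fin (n G) → Bool) → Set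
IsBipartition G part = ∀ u v → adj G u v ≡ true → part u ≢ part v

_∩_ : {G : Graph} → VSet G → VSet G → VSet G
(A ∩ B) v = A v × B v

_∪_ : {G : Graph} → VSet G → VSet G → VSet G
(A ∪ B) v = A v ⊎ B v

_⊆_ : {G : Graph} → VSet G → VSet G → Set
A ⊆ B = ∀ v → A v → B v

PartSet : (G : Graph) → (Fin (n G) → Bool) → Bool → VSet G
PartSet G part b v = part v ≡ b

-- Zero forcing closure C_G(T): the least set containing T closed under
-- "if x is in the set and y is the unique neighbour of x outside the set,
-- add y" (the result of the repeated forcing process).
data C (G : Graph) (T : VSet G) : VSet G where
  base  : ∀ {v} → T v → C G T v
  force : ∀ {x y} → C G T x → adj G x y ≡ true →
          (∀ z → adj G x z ≡ true → z ≢ y → C G T z) → C G T y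

data C* (G : Graph) (T : VSet G) : VSet G where
  base  : ∀ {v} → T v → C* G T v
  force : ∀ {x y} → adj G x y ≡ true →
          (∀ z → adj G x z ≡ true → z ≢ y → C* G T z) → C* G T y

module Submission where

open import Defs hiding (sym)
open import Data.Bool using (Bool; true; false; not)
open import Data.Bool.Properties using (¬-not)
open import Data.Fin using (Fin)
open import Data.Product using (_,_)
open import Data.Sum using (inj₁; inj₂)
open import Relation.Binary.PropositionalEquality using (_≡_; trans; sym; ≢-sym)

-- A force x → y in C_G(T) only uses the neighbours of x, which all lie in the
-- part opposite to x, i.e. in the part of y. So the force is still available
-- in the star closure of the trace of T on that part, where x itself need not
-- belong to the set.

module _ (G : Graph) (part : Fin (n G) → Bool) (bip : IsBipartition G part) where

  neighbour-part : ∀ {x y} → adj G x y ≡ true → part y ≡ not (part x)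
  neighbour-part e = ¬-not (≢-sym (bip _ _ e))

  common-neighbours-same-part : ∀ {x y z} →
    adj G x y ≡ true → adj G x z ≡ true → part y ≡ part z
  common-neighbours-same-part exy exz =
    trans (neighbour-part exy) (sym (neighbour-part exz))

  C⊆C*-trace : (T : VSet G) (b : Bool) →
    ∀ {v} → C G T v → part v ≡ b → C* G (_∩_ {G} T (PartSet G part b)) v
  C⊆C*-trace T b (base t) pv = base (t , pv)
  C⊆C*-trace T b (force _ exy others) py =
    force exy (λ z exz z≢y →
      C⊆C*-trace T b (others z exz z≢y)
        (trans (common-neighbours-same-part exz exy) py))

lemma2p1 : (G : Graph) (part : Fin (n G) → Bool) →
    IsBipartition G part → MinDegAtLeast G 2 → (T : VSet G) →
    _⊆_ {G} (C G T)
      (_∪_ {G} (C* G (_∩_ {G} T (PartSet G part true)))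
               (C* G (_∩_ {G} T (PartSet G part false))))
lemma2p1 G part bip _ T v cv with part v in pv
... | true  = inj₁ (C⊆C*-trace G part bip T true cv pv)
... | false = inj₂ (C⊆C*-trace G part bip T false cv pv)
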